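{- (Truth lemma) For every state $s$ of the canonical model $\mathcal{M}^c$ of $\mathbb{LUT}$ and every formula $\phi$ of $\mathbf{LUT}$: $\mathcal{M}^c,s\vDash\phi$ if and only if $\phi\in s$.
   Context: The language $\mathbf{LUT}$ over a countably infinite set $\mathbf{P}$ of propositional variables and a finite set $\mathbf{I}$ of agents is $\phi::= p\mid\neg\phi\mid(\phi\land\phi)\mid K_i\phi\mid[\phi]\phi\mid U_i\phi$; $\mathbf{EL}$ is the fragment without $[\cdot]$ and $U_i$. Semantics on a structure $\mathcal{M}=\langle S,\{R_i\},V\rangle$: $p$ true at $s$ iff $s\in V(p)$; Boolean clauses as usual; $\mathcal{M},s\vDash K_i\phi$ iff $\phi$ holds at all $t$ with $sR_it$; $\mathcal{M},s\vDash[\psi]\phi$ iff ($\mathcal{M},s\vDash\psi$ implies $\mathcal{M}|_\psi,s\vDash\phi$), with $\mathcal{M}|_\psi$ the restriction of $\mathcal{M}$ to the states where $\psi$ is true; $\mathcal{M},s\vDash U_i\phi$ iff $\mathcal{M},s\vDash\phi$ and $\mathcal{M},s\vDash[\psi]\neg K_i\phi$ for all $\psi\in\mathbf{EL}$. Admissible forms: $\eta(\sharp)::=\sharp\mid\phi\to\eta(\sharp)\mid K_i\eta(\sharp)\mid[\phi]\eta(\sharp)$; $\eta(\chi)$ replaces $\sharp$ by $\chi$. The proof system $\mathbb{LUT}$ has axioms: propositional tautologies; $K_i(\phi\to\psi)\to(K_i\phi\to K_i\psi)$; $[\chi](\phi\to\psi)\to([\chi]\phi\to[\chi]\psi)$;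 $K_i\phi\to\phi$; $[\psi]p\leftrightarrow(\psi\to p)$; $[\psi]\neg\phi\leftrightarrow(\psi\to\neg[\psi]\phi)$; $[\psi](\phi\land\chi)\leftrightarrow([\psi]\phi\land[\psi]\chi)$; $[\psi]K_i\phi\leftrightarrow(\psi\to K_i[\psi]\phi)$; $[\psi][\chi]\phi\leftrightarrow[\psi\land[\psi]\chi]\phi$; $U_i\phi\to\phi\land[\psi]\neg K_i\phi$ for each $\psi\in\mathbf{EL}$; rules: modus ponens (MP), $\phi/K_i\phi$, $\phi/[\chi]\phi$, and RU: from $\eta(\phi\land[\psi]\neg K_i\phi)$ for all $\psi\in\mathbf{EL}$ infer $\eta(U_i\phi)$, for any admissible form $\eta$. Let $\mathbf{Thm}$ be its set of theorems. A set $s$ of formulas is a theory if $\mathbf{Thm}\subseteq s$ and $s$ is closed under MP and RU; it is maximal consistent if $\bot\notin s$ and for every $\phi$ either $\phi\in s$ or $\neg\phi\in s$. The canonical model is $\mathcal{M}^c=\langle S^c,\{R^c_i\}_{i\in\mathbf{I}},V^c\rangle$, where $S^c$ is the set of all maximal consistent theories, $sR^c_it$ iff $\{\phi\mid K_i\phi\in s\}\subseteq t$, and $V^c(p)=\{s\in S^c\mid p\in s\}$. -}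

module Defs where

open import Level using (Level; _⊔_; 0ℓ; Lift) renaming (suc to lsuc)
open import Data.Nat using (ℕ)
open import Data.Fin using (Fin)
open import Data.Bool using (Bool; true; false; not) renaming (_∧_ to _∧ᵇ_)
open import Data.Product using (Σ; _×_; _,_; proj₁)
open import Data.Sum using (_⊎_)
open import Relation.Nullary using (¬_)
open import Relation.Binary.PropositionalEquality using (_≡_)

infix  9 ~_
infixr 7 _&_
infixr 6 _⇒_
infix  5 _⇔f_
infixr 8 [_]_

data Form (n : ℕ) : Set where
  var  : ℕ → Form n
  ~_   : Form n → Form n
  _&_  : Form n → Form n → Form n
  K    : Fin n → Form n → Form n
  [_]_ : Form n → Form n → Form n
  U    : Fin n → Form n → Form n

data EL (n : ℕ) : Set where
  var  : ℕ → EL n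
  ~_   : EL n → EL n
  _&_  : EL n → EL n → EL n
  K    : Fin n → EL n → EL n

⌜_⌝ : ∀ {n} → EL n → Form n
⌜ var p ⌝   = var p
⌜ ~ φ ⌝     = ~ ⌜ φ ⌝
⌜ φ & ψ ⌝   = ⌜ φ ⌝ & ⌜ ψ ⌝
⌜ K i φ ⌝   = K i ⌜ φ ⌝

_⇒_ : ∀ {n} → Form n → Form n → Form n
φ ⇒ ψ = ~ (φ & ~ ψ)

_⇔f_ : ∀ {n} → Form n → Form n → Form n
φ ⇔f ψ = (φ ⇒ ψ) & (ψ ⇒ φ)

⊥f : ∀ {n} → Form n
⊥f = var 0 & ~ var 0

-- Propositional tautologies: valid under every Boolean valuation that
-- treats variables and K/[.]/U-formulas as atoms.

evalB : ∀ {n} → (Form n → Bool) → Form n → Bool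
evalB v (~ φ)   = not (evalB v φ)
evalB v (φ & ψ) = evalB v φ ∧ᵇ evalB v ψ
evalB v φ       = v φ

Taut : ∀ {n} → Form n → Set
Taut {n} φ = (v : Form n → Bool) → evalB v φ ≡ true

data Adm (n : ℕ) : Set where
  ♯     : Adm n
  _⇒η_  : Form n → Adm n → Adm n
  Kη    : Fin n → Adm n → Adm n
  [_]η_ : Form n → Adm n → Adm n

plug : ∀ {n} → Adm n → Form n → Form n
plug ♯          χ = χ
plug (φ ⇒η η)   χ = φ ⇒ plug η χ
plug (Kη i η)   χ = K i (plug η χ)
plug ([ φ ]η η) χ = [ φ ] plug η χ

RUprem : ∀ {n} → Fin n → Form n → EL n → Form n
RUprem i φ ψ = φ & ([ ⌜ ψ ⌝ ] ~ K i φ)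

data ⊢_ {n : ℕ} : Form n → Set where
  taut   : ∀ {φ} → Taut φ → ⊢ φ
  K-dist : ∀ {i φ ψ} → ⊢ (K i (φ ⇒ ψ) ⇒ (K i φ ⇒ K i ψ))
  A-dist : ∀ {χ φ ψ} → ⊢ ([ χ ] (φ ⇒ ψ) ⇒ ([ χ ] φ ⇒ [ χ ] ψ))
  T      : ∀ {i φ} → ⊢ (K i φ ⇒ φ)
  A-atom : ∀ {ψ p} → ⊢ (([ ψ ] var p) ⇔f (ψ ⇒ var p))
  A-neg  : ∀ {ψ φ} → ⊢ (([ ψ ] ~ φ) ⇔f (ψ ⇒ ~ ([ ψ ] φ)))
  A-conj : ∀ {ψ φ χ} → ⊢ (([ ψ ] (φ & χ)) ⇔f (([ ψ ] φ) & ([ ψ ] χ)))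
  A-K    : ∀ {ψ i φ} → ⊢ (([ ψ ] K i φ) ⇔f (ψ ⇒ K i ([ ψ ] φ)))
  A-comp : ∀ {ψ χ φ} → ⊢ (([ ψ ] [ χ ] φ) ⇔f ([ ψ & ([ ψ ] χ) ] φ))
  U-ax   : ∀ {i φ} (ψ : EL n) → ⊢ (U i φ ⇒ RUprem i φ ψ)
  MP     : ∀ {φ ψ} → ⊢ (φ ⇒ ψ) → ⊢ φ → ⊢ ψ
  NecK   : ∀ {i φ} → ⊢ φ → ⊢ K i φ
  NecA   : ∀ {χ φ} → ⊢ φ → ⊢ ([ χ ] φ)
  RU     : ∀ {i φ} (η : Adm n) →
           ((ψ : EL n) → ⊢ plug η (RUprem i φ ψ)) → ⊢ plug η (U i φ)

-- Models and semantics.  A "domain" D picks out the live states; the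
-- restriction M|ψ is represented by shrinking the domain.

record Model (n : ℕ) (a r v : Level) : Set (lsuc (a ⊔ r ⊔ v)) where
  field
    S : Set a
    R : Fin n → S → S → Set r
    V : ℕ → S → Set v

module Semantics {n : ℕ} {a r v : Level} (M : Model n a r v) where
  open Model M

  Dom : Set (lsuc (a ⊔ r ⊔ v))
  Dom = S → Set (a ⊔ r ⊔ v)

  satEL : Dom → S → EL n → Set (a ⊔ r ⊔ v)
  satEL D s (var p) = Lift (a ⊔ r) (V p s)
  satEL D s (~ φ)   = ¬ satEL D s φ
  satEL D s (φ & ψ) = satEL D s φ × satEL D s ψ
  satEL D s (K i φ) = ∀ t → D t → R i s t → satEL D t φ

  sat : Dom → S → Form n → Set (a ⊔ r ⊔ v)
  sat D s (var p)     = Lift (a ⊔ r) (V p s)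
  sat D s (~ φ)       = ¬ sat D s φ
  sat D s (φ & ψ)     = sat D s φ × sat D s ψ
  sat D s (K i φ)     = ∀ t → D t → R i s t → sat D t φ
  sat D s ([ ψ ] φ)   = sat D s ψ → sat (λ t → D t × sat D t ψ) s φ
  sat D s (U i φ)     =
    sat D s φ ×
    ((ψ : EL n) → satEL D s ψ →
       ¬ (∀ t → (D t × satEL D t ψ) → R i s t →
            sat (λ u → D u × satEL D u ψ) t φ))

  _⊨_ : S → Form n → Set (a ⊔ r ⊔ v)
  s ⊨ φ = sat (λ _ → Lift (a ⊔ r ⊔ v) Data.Unit.⊤) s φ
    where import Data.Unit

FSet : ℕ → Set₁
FSet n = Form n → Set

IsTheory : ∀ {n} → FSet n → Set
IsTheory {n} s =
  (∀ φ → ⊢ φ → s φ) ×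
  (∀ φ ψ → s (φ ⇒ ψ) → s φ → s ψ) ×
  (∀ (η : Adm n) i φ → ((ψ : EL n) → s (plug η (RUprem i φ ψ))) →
     s (plug η (U i φ)))

IsMCT : ∀ {n} → FSet n → Set
IsMCT {n} s = IsTheory s × ¬ s ⊥f × (∀ φ → s φ ⊎ s (~ φ))

Sᶜ : ℕ → Set₁
Sᶜ n = Σ (FSet n) IsMCT

Mᶜ : (n : ℕ) → Model n (lsuc 0ℓ) 0ℓ 0ℓ
Mᶜ n = record
  { S = Sᶜ n
  ; R = λ i s t → ∀ φ → proj₁ s (K i φ) → proj₁ t φ
  ; V = λ p s → proj₁ s (var p)
  }

-- The truth lemma is proved by lexicographic induction on (U-rank, complexity).
-- Announcements are pushed inwards by the reduction axioms, each of which lowers the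
-- complexity. A formula U_i φ is unfolded semantically into φ and the formulas [ψ]¬K_i φ
-- (ψ ∈ EL), and syntactically by the U-axiom and the rule RU; this lowers the U-rank
-- because EL-formulas contain no U (under an announcement [Ψ] the same works with the
-- admissible form [Ψ]♯). The one modal case is K_i: if K_i φ ∉ s, a Lindenbaum
-- construction along an enumeration of all formulas extends {χ | K_i χ ∈ s} ∪ {¬φ} to a
-- maximal consistent theory. To keep the limit closed under RU, a rejected formula
-- η(U_j ξ) is rejected together with some instance ¬η(ξ ∧ [ψ]¬K_j ξ) of its premise;
-- such a ψ exists because s itself is closed under RU. Excluded middle makes the choices
-- of the construction and gives implication its classical meaning in the semantics.

module Submission where

open import Defs
open import Level using (0ℓ; Lift; lift; lower; _⊔_) renaming (suc to lsuc)
open import Data.Nat using (ℕ; zero; suc; _+_; _*_; _≤_; _<_; _≤′_; ≤′-refl; ≤′-step; z≤n; s≤s)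
  renaming (_⊔_ to _⊔ⁿ_)
open import Data.Nat.Properties
  using (≤-refl; ≤-trans; ≤-reflexive; ≤-pred; ≤-<-trans; ≤⇒≤′; m≤m+n; m<m+n;
         m≤m⊔n; m≤n⊔m; m≤n+m; ⊔-lub; *-mono-<; +-monoˡ-≤; +-monoʳ-<; +-assoc; +-distribˡ-⊔)
open import Data.Nat.Tactic.RingSolver using (solve-∀)
open import Data.Fin using (Fin)
open import Data.Fin.Patterns using (0F; 1F; 2F)
open import Data.Bool using (Bool; true; false; not) renaming (_∧_ to _∧ᵇ_)
open import Data.Bool.Properties using (∧-inverseʳ; ∧-conicalˡ; ∧-conicalʳ)
open import Data.Vec using (Vec; []; _∷_; lookup; map)
open import Data.Vec.Properties using (lookup-map)
open import Data.List using (List; []; _∷_; _++_; allFin; cartesianProductWith)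
import Data.List as List
open import Data.List.Relation.Unary.Any using (here; there)
open import Data.List.Membership.Propositional using (_∈_)
open import Data.List.Membership.Propositional.Properties
  using (∈-map⁺; ∈-++⁺ˡ; ∈-++⁺ʳ; ∈-cartesianProductWith⁺; ∈-allFin)
open import Data.List.Relation.Binary.Subset.Propositional using (_⊆_)
open import Data.Maybe using (Maybe; just; nothing)
import Data.Maybe as Maybe
open import Data.Maybe.Properties using (just-injective)
open import Data.Product as Product using (Σ; ∃; _×_; _,_; proj₁; proj₂)
open import Data.Product.Function.NonDependent.Propositional using (_×-⇔_)
open import Data.Sum as Sum using (_⊎_; inj₁; inj₂)
open import Data.Empty using (⊥-elim)
open import Data.Unit using (⊤)
open import Function using (id; _∘_)
open import Function.Bundles using (_⇔_; mk⇔; Equivalence)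
import Function.Properties.Equivalence as ⇔
open import Function.Related.TypeIsomorphisms using (→-cong-⇔; ¬-cong-⇔)
open import Relation.Nullary using (¬_; Dec; yes; no)
open import Relation.Nullary.Decidable using (map′; decidable-stable)
open import Relation.Binary.PropositionalEquality
  using (_≡_; refl; sym; trans; cong; cong₂; subst)
open import Axiom.ExcludedMiddle using (ExcludedMiddle)

open Equivalence using (to; from)

infix  9 `¬_
infixr 7 _`∧_
infixr 6 _`⇒_

data Schema (k : ℕ) : Set where
  `_   : Fin k → Schema k
  `⊥   : Schema k
  `¬_  : Schema k → Schema k
  _`∧_ : Schema k → Schema k → Schema k

_`⇒_ : ∀ {k} → Schema k → Schema k → Schema k
P `⇒ Q = `¬ (P `∧ `¬ Q)

_⟪_⟫ : ∀ {n k} → Vec (Form n) k → Schema k → Form n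
σ ⟪ ` x ⟫    = lookup σ x
σ ⟪ `⊥ ⟫     = ⊥f
σ ⟪ `¬ P ⟫   = ~ (σ ⟪ P ⟫)
σ ⟪ P `∧ Q ⟫ = σ ⟪ P ⟫ & σ ⟪ Q ⟫

evalSchema : ∀ {k} → Vec Bool k → Schema k → Bool
evalSchema ρ (` x)    = lookup ρ x
evalSchema ρ `⊥       = false
evalSchema ρ (`¬ P)   = not (evalSchema ρ P)
evalSchema ρ (P `∧ Q) = evalSchema ρ P ∧ᵇ evalSchema ρ Q

evalB-⟪⟫ : ∀ {n k} (v : Form n → Bool) (σ : Vec (Form n) k) (P : Schema k) →
           evalB v (σ ⟪ P ⟫) ≡ evalSchema (map (evalB v) σ) P
evalB-⟪⟫ v σ (` x)    = sym (lookup-map x (evalB v) σ)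
evalB-⟪⟫ v σ `⊥       = ∧-inverseʳ (v (var 0))
evalB-⟪⟫ v σ (`¬ P)   = cong not (evalB-⟪⟫ v σ P)
evalB-⟪⟫ v σ (P `∧ Q) = cong₂ _∧ᵇ_ (evalB-⟪⟫ v σ P) (evalB-⟪⟫ v σ Q)

allTrue : ∀ k → (Vec Bool k → Bool) → Bool
allTrue zero    f = f []
allTrue (suc k) f = allTrue k (f ∘ (true ∷_)) ∧ᵇ allTrue k (f ∘ (false ∷_))

allTrue-sound : ∀ k (f : Vec Bool k → Bool) → allTrue k f ≡ true → ∀ ρ → f ρ ≡ true
allTrue-sound zero    f h []          = h
allTrue-sound (suc k) f h (true ∷ ρ)  = allTrue-sound k _ (∧-conicalˡ _ _ h) ρ
allTrue-sound (suc k) f h (false ∷ ρ) = allTrue-sound k _ (∧-conicalʳ _ _ h) ρ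

tautology : ∀ {n k} (P : Schema k) → allTrue k (λ ρ → evalSchema ρ P) ≡ true →
            (σ : Vec (Form n) k) → ⊢ (σ ⟪ P ⟫)
tautology {k = k} P valid σ =
  taut λ v → trans (evalB-⟪⟫ v σ P) (allTrue-sound k _ valid (map (evalB v) σ))

𝑎 : ∀ {k} → Schema (suc k)
𝑎 = ` 0F

𝑏 : ∀ {k} → Schema (2 + k)
𝑏 = ` 1F

𝑐 : ∀ {k} → Schema (3 + k)
𝑐 = ` 2F

⊤f : ∀ {n} → Form n
⊤f = ~ ⊥f

&-elimˡ : ∀ {n} {A B : Form n} → ⊢ (A & B ⇒ A)
&-elimˡ {A = A} {B} = tautology (𝑎 `∧ 𝑏 `⇒ 𝑎) refl (A ∷ B ∷ [])

&-elimʳ : ∀ {n} {A B : Form n} → ⊢ (A & B ⇒ B)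
&-elimʳ {A = A} {B} = tautology (𝑎 `∧ 𝑏 `⇒ 𝑏) refl (A ∷ B ∷ [])

&-intro : ∀ {n} {A B : Form n} → ⊢ (A ⇒ B ⇒ A & B)
&-intro {A = A} {B} = tautology (𝑎 `⇒ 𝑏 `⇒ 𝑎 `∧ 𝑏) refl (A ∷ B ∷ [])

~-elim : ∀ {n} {A : Form n} → ⊢ (A ⇒ ~ A ⇒ ⊥f)
~-elim {A = A} = tautology (𝑎 `⇒ `¬ 𝑎 `⇒ `⊥) refl (A ∷ [])

ex-falso : ∀ {n} {A : Form n} → ⊢ (⊥f ⇒ A)
ex-falso {A = A} = tautology (`⊥ `⇒ 𝑎) refl (A ∷ [])

⊤-intro : ∀ {n} {A : Form n} → ⊢ (A ⇒ ⊤f)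
⊤-intro {A = A} = tautology (𝑎 `⇒ `¬ `⊥) refl (A ∷ [])

⊤-⇒-elim : ∀ {n} {A : Form n} → ⊢ ((⊤f ⇒ A) ⇒ A)
⊤-⇒-elim {A = A} = tautology ((`¬ `⊥ `⇒ 𝑎) `⇒ 𝑎) refl (A ∷ [])

⇒-weaken : ∀ {n} {A B : Form n} → ⊢ (A ⇒ B ⇒ A)
⇒-weaken {A = A} {B} = tautology (𝑎 `⇒ 𝑏 `⇒ 𝑎) refl (A ∷ B ∷ [])

⇒-trans : ∀ {n} {A B C : Form n} → ⊢ ((A ⇒ B) ⇒ (B ⇒ C) ⇒ (A ⇒ C))
⇒-trans {A = A} {B} {C} = tautology ((𝑎 `⇒ 𝑏) `⇒ (𝑏 `⇒ 𝑐) `⇒ (𝑎 `⇒ 𝑐)) refl (A ∷ B ∷ C ∷ [])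

⇒-mp : ∀ {n} {A B C : Form n} → ⊢ ((A ⇒ B ⇒ C) ⇒ (A ⇒ B) ⇒ (A ⇒ C))
⇒-mp {A = A} {B} {C} = tautology ((𝑎 `⇒ 𝑏 `⇒ 𝑐) `⇒ (𝑎 `⇒ 𝑏) `⇒ (𝑎 `⇒ 𝑐)) refl (A ∷ B ∷ C ∷ [])

⇒-&-intro : ∀ {n} {A B C : Form n} → ⊢ ((A ⇒ B) ⇒ (A ⇒ C) ⇒ (A ⇒ B & C))
⇒-&-intro {A = A} {B} {C} = tautology ((𝑎 `⇒ 𝑏) `⇒ (𝑎 `⇒ 𝑐) `⇒ (𝑎 `⇒ 𝑏 `∧ 𝑐)) refl (A ∷ B ∷ C ∷ [])

&-⇒-weakenˡ : ∀ {n} {A B C : Form n} → ⊢ ((B ⇒ C) ⇒ (A & B ⇒ C))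
&-⇒-weakenˡ {A = A} {B} {C} = tautology ((𝑏 `⇒ 𝑐) `⇒ (𝑎 `∧ 𝑏 `⇒ 𝑐)) refl (A ∷ B ∷ C ∷ [])

⇒-clash : ∀ {n} {A B P : Form n} → ⊢ ((A ⇒ B) ⇒ (A ⇒ ~ B) ⇒ (A ⇒ P))
⇒-clash {A = A} {B} {P} = tautology ((𝑎 `⇒ 𝑏) `⇒ (𝑎 `⇒ `¬ 𝑏) `⇒ (𝑎 `⇒ 𝑐)) refl (A ∷ B ∷ P ∷ [])

&-⇒-cases : ∀ {n} {A B P : Form n} → ⊢ ((A & B ⇒ P) ⇒ (~ A & B ⇒ P) ⇒ (B ⇒ P))
&-⇒-cases {A = A} {B} {P} =
  tautology ((𝑎 `∧ 𝑏 `⇒ 𝑐) `⇒ (`¬ 𝑎 `∧ 𝑏 `⇒ 𝑐) `⇒ (𝑏 `⇒ 𝑐)) refl (A ∷ B ∷ P ∷ [])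

&-⇒-contrapose : ∀ {n} {A B P : Form n} → ⊢ ((~ A & B ⇒ P) ⇒ (B & ~ P ⇒ A))
&-⇒-contrapose {A = A} {B} {P} =
  tautology ((`¬ 𝑎 `∧ 𝑏 `⇒ 𝑐) `⇒ (𝑏 `∧ `¬ 𝑐 `⇒ 𝑎)) refl (A ∷ B ∷ P ∷ [])

&-⇒-reductio : ∀ {n} {A B P : Form n} → ⊢ (((~ A & B) & ~ P ⇒ A) ⇒ (~ A & B ⇒ P))
&-⇒-reductio {A = A} {B} {P} =
  tautology (((`¬ 𝑎 `∧ 𝑏) `∧ `¬ 𝑐 `⇒ 𝑎) `⇒ (`¬ 𝑎 `∧ 𝑏 `⇒ 𝑐)) refl (A ∷ B ∷ P ∷ [])

module MaximalConsistent {n : ℕ} (s : Sᶜ n) where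

  Γ : FSet n
  Γ = proj₁ s

  theorem∈ : ∀ {φ} → ⊢ φ → Γ φ
  theorem∈ {φ} = proj₁ (proj₁ (proj₂ s)) φ

  mp∈ : ∀ {φ ψ} → Γ (φ ⇒ ψ) → Γ φ → Γ ψ
  mp∈ {φ} {ψ} = proj₁ (proj₂ (proj₁ (proj₂ s))) φ ψ

  ru∈ : ∀ (η : Adm n) i φ → ((ψ : EL n) → Γ (plug η (RUprem i φ ψ))) → Γ (plug η (U i φ))
  ru∈ = proj₂ (proj₂ (proj₁ (proj₂ s)))

  ⊥f∉ : ¬ Γ ⊥f
  ⊥f∉ = proj₁ (proj₂ (proj₂ s))

  ∈-or-~∈ : ∀ φ → Γ φ ⊎ Γ (~ φ)
  ∈-or-~∈ = proj₂ (proj₂ (proj₂ s))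

  ⊢⇒∈ : ∀ {φ ψ} → ⊢ (φ ⇒ ψ) → Γ φ → Γ ψ
  ⊢⇒∈ = mp∈ ∘ theorem∈

  ⊢⇒∈₂ : ∀ {φ ψ χ} → ⊢ (φ ⇒ ψ ⇒ χ) → Γ φ → Γ ψ → Γ χ
  ⊢⇒∈₂ h = mp∈ ∘ ⊢⇒∈ h

  ~∈⇒∉ : ∀ {φ} → Γ (~ φ) → ¬ Γ φ
  ~∈⇒∉ ~φ∈ φ∈ = ⊥f∉ (⊢⇒∈₂ ~-elim φ∈ ~φ∈)

  ∉⇒~∈ : ∀ {φ} → ¬ Γ φ → Γ (~ φ)
  ∉⇒~∈ {φ} φ∉ with ∈-or-~∈ φ
  ... | inj₁ φ∈  = ⊥-elim (φ∉ φ∈)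
  ... | inj₂ ~φ∈ = ~φ∈

  ∈-stable : ∀ {φ} → ¬ ¬ Γ φ → Γ φ
  ∈-stable {φ} ¬φ∉ with ∈-or-~∈ φ
  ... | inj₁ φ∈  = φ∈
  ... | inj₂ ~φ∈ = ⊥-elim (¬φ∉ (~∈⇒∉ ~φ∈))

  &∈⇔ : ∀ {φ ψ} → Γ (φ & ψ) ⇔ (Γ φ × Γ ψ)
  &∈⇔ = mk⇔ (λ h → ⊢⇒∈ &-elimˡ h , ⊢⇒∈ &-elimʳ h) (λ (φ∈ , ψ∈) → ⊢⇒∈₂ &-intro φ∈ ψ∈)

  ⇔f∈ : ∀ {φ ψ} → ⊢ (φ ⇔f ψ) → Γ φ ⇔ Γ ψ
  ⇔f∈ h = mk⇔ (⊢⇒∈ (MP &-elimˡ h)) (⊢⇒∈ (MP &-elimʳ h))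

  K-⊢⇒∈ : ∀ {i φ ψ} → ⊢ (φ ⇒ ψ) → Γ (K i φ) → Γ (K i ψ)
  K-⊢⇒∈ h = ⊢⇒∈ (MP K-dist (NecK h))

  K-⊢⇒∈₂ : ∀ {i φ ψ χ} → ⊢ (φ ⇒ ψ ⇒ χ) → Γ (K i φ) → Γ (K i ψ) → Γ (K i χ)
  K-⊢⇒∈₂ h = mp∈ ∘ ⊢⇒∈ K-dist ∘ K-⊢⇒∈ h

  U∈⇔ : ∀ {j φ} → Γ (U j φ) ⇔ (Γ φ × ((ψ : EL n) → Γ ([ ⌜ ψ ⌝ ] ~ K j φ)))
  U∈⇔ {j} {φ} = mk⇔
    (λ Uφ∈ → proj₁ (premise (var 0) Uφ∈) , λ ψ → proj₂ (premise ψ Uφ∈))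
    (λ (φ∈ , ¬K∈) → ru∈ ♯ j φ λ ψ → from &∈⇔ (φ∈ , ¬K∈ ψ))
    where
      premise : ∀ ψ → Γ (U j φ) → Γ φ × Γ ([ ⌜ ψ ⌝ ] ~ K j φ)
      premise ψ = to &∈⇔ ∘ ⊢⇒∈ (U-ax ψ)

  []U∈⇔ : ∀ {Ψ j φ} → Γ ([ Ψ ] U j φ) ⇔ (Γ ([ Ψ ] φ) × ((ψ : EL n) → Γ ([ Ψ ] [ ⌜ ψ ⌝ ] ~ K j φ)))
  []U∈⇔ {Ψ} {j} {φ} = mk⇔
    (λ h → proj₁ (premise (var 0) h) , λ ψ → proj₂ (premise ψ h))
    (λ (φ∈ , ¬K∈) → ru∈ ([ Ψ ]η ♯) j φ λ ψ → from (⇔f∈ A-conj) (from &∈⇔ (φ∈ , ¬K∈ ψ)))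
    where
      premise : ∀ ψ → Γ ([ Ψ ] U j φ) → Γ ([ Ψ ] φ) × Γ ([ Ψ ] [ ⌜ ψ ⌝ ] ~ K j φ)
      premise ψ = to &∈⇔ ∘ to (⇔f∈ A-conj) ∘ ⊢⇒∈ (MP A-dist (NecA (U-ax ψ)))

⋀ : ∀ {n} → List (Form n) → Form n
⋀ []      = ⊤f
⋀ (φ ∷ L) = φ & ⋀ L

⋀-∈ : ∀ {n} {φ : Form n} {L} → φ ∈ L → ⊢ (⋀ L ⇒ φ)
⋀-∈ (here refl) = &-elimˡ
⋀-∈ (there φ∈L) = MP &-⇒-weakenˡ (⋀-∈ φ∈L)

⋀-⊆ : ∀ {n} {L L′ : List (Form n)} → L ⊆ L′ → ⊢ (⋀ L′ ⇒ ⋀ L)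
⋀-⊆ {L = []}    _   = ⊤-intro
⋀-⊆ {L = φ ∷ L} L⊆L′ = MP (MP ⇒-&-intro (⋀-∈ (L⊆L′ (here refl)))) (⋀-⊆ (L⊆L′ ∘ there))

height : ∀ {n} → Form n → ℕ
height (var p)   = suc p
height (~ φ)     = suc (height φ)
height (φ & ψ)   = suc (height φ ⊔ⁿ height ψ)
height (K i φ)   = suc (height φ)
height ([ φ ] ψ) = suc (height φ ⊔ⁿ height ψ)
height (U i φ)   = suc (height φ)

module _ {n : ℕ} where

  module _ (F : List (Form n)) where
    private
      negations conjunctions boxes announcements understandings : List (Form n)
      negations      = List.map ~_ F
      conjunctions   = cartesianProductWith _&_ F F
      boxes          = cartesianProductWith K (allFin n) F
      announcements  = cartesianProductWith [_]_ F F
      understandings = cartesianProductWith U (allFin n) F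

    compounds : List (Form n)
    compounds = negations ++ conjunctions ++ boxes ++ announcements ++ understandings

    ∈-compounds-~ : ∀ {φ} → φ ∈ F → ~ φ ∈ compounds
    ∈-compounds-~ = ∈-++⁺ˡ ∘ ∈-map⁺ ~_

    ∈-compounds-& : ∀ {φ ψ} → φ ∈ F → ψ ∈ F → φ & ψ ∈ compounds
    ∈-compounds-& φ∈ ψ∈ =
      ∈-++⁺ʳ negations (∈-++⁺ˡ (∈-cartesianProductWith⁺ _&_ φ∈ ψ∈))

    ∈-compounds-K : ∀ i {φ} → φ ∈ F → K i φ ∈ compounds
    ∈-compounds-K i φ∈ =
      ∈-++⁺ʳ negations (∈-++⁺ʳ conjunctions (∈-++⁺ˡ (∈-cartesianProductWith⁺ K (∈-allFin i) φ∈)))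

    ∈-compounds-[] : ∀ {φ ψ} → φ ∈ F → ψ ∈ F → [ φ ] ψ ∈ compounds
    ∈-compounds-[] φ∈ ψ∈ =
      ∈-++⁺ʳ negations (∈-++⁺ʳ conjunctions (∈-++⁺ʳ boxes
        (∈-++⁺ˡ (∈-cartesianProductWith⁺ [_]_ φ∈ ψ∈))))

    ∈-compounds-U : ∀ i {φ} → φ ∈ F → U i φ ∈ compounds
    ∈-compounds-U i φ∈ =
      ∈-++⁺ʳ negations (∈-++⁺ʳ conjunctions (∈-++⁺ʳ boxes (∈-++⁺ʳ announcements
        (∈-cartesianProductWith⁺ U (∈-allFin i) φ∈))))

  enumeration : ℕ → List (Form n)
  enumeration zero    = []
  enumeration (suc k) = enumeration k ++ var k ∷ compounds (enumeration k)

  enumeration-⊆ : ∀ {k k′} → k ≤ k′ → enumeration k ⊆ enumeration k′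
  enumeration-⊆ = go ∘ ≤⇒≤′
    where
      go : ∀ {k k′} → k ≤′ k′ → enumeration k ⊆ enumeration k′
      go ≤′-refl         = id
      go (≤′-step k≤′k′) = ∈-++⁺ˡ ∘ go k≤′k′

  compounds-⊆-enumeration : ∀ {k} → compounds (enumeration k) ⊆ enumeration (suc k)
  compounds-⊆-enumeration = ∈-++⁺ʳ _ ∘ there

  ∈-enumeration : ∀ φ → φ ∈ enumeration (height φ)

  ∈-enumeration-⊔ˡ : ∀ φ ψ → φ ∈ enumeration (height φ ⊔ⁿ height ψ)
  ∈-enumeration-⊔ˡ φ ψ = enumeration-⊆ (m≤m⊔n (height φ) (height ψ)) (∈-enumeration φ)

  ∈-enumeration-⊔ʳ : ∀ φ ψ → ψ ∈ enumeration (height φ ⊔ⁿ height ψ)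
  ∈-enumeration-⊔ʳ φ ψ = enumeration-⊆ (m≤n⊔m (height φ) (height ψ)) (∈-enumeration ψ)

  ∈-enumeration (var p)   = ∈-++⁺ʳ (enumeration p) (here refl)
  ∈-enumeration (~ φ)     = compounds-⊆-enumeration (∈-compounds-~ _ (∈-enumeration φ))
  ∈-enumeration (φ & ψ)   =
    compounds-⊆-enumeration (∈-compounds-& _ (∈-enumeration-⊔ˡ φ ψ) (∈-enumeration-⊔ʳ φ ψ))
  ∈-enumeration (K i φ)   = compounds-⊆-enumeration (∈-compounds-K _ i (∈-enumeration φ))
  ∈-enumeration ([ φ ] ψ) =
    compounds-⊆-enumeration (∈-compounds-[] _ (∈-enumeration-⊔ˡ φ ψ) (∈-enumeration-⊔ʳ φ ψ))
  ∈-enumeration (U i φ)   = compounds-⊆-enumeration (∈-compounds-U _ i (∈-enumeration φ))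

splitU : ∀ {n} → Form n → Maybe (Adm n × Fin n × Form n)
splitU (U j ξ)       = just (♯ , j , ξ)
splitU (~ (a & ~ X)) = Maybe.map (λ (η , j , ξ) → a ⇒η η , j , ξ) (splitU X)
splitU (K i X)       = Maybe.map (λ (η , j , ξ) → Kη i η , j , ξ) (splitU X)
splitU ([ a ] X)     = Maybe.map (λ (η , j , ξ) → [ a ]η η , j , ξ) (splitU X)
splitU _             = nothing

splitU-plug : ∀ {n} (η : Adm n) j ξ → splitU (plug η (U j ξ)) ≡ just (η , j , ξ)
splitU-plug ♯          j ξ = refl
splitU-plug (a ⇒η η)   j ξ = cong (Maybe.map _) (splitU-plug η j ξ)
splitU-plug (Kη i η)   j ξ = cong (Maybe.map _) (splitU-plug η j ξ)
splitU-plug ([ a ]η η) j ξ = cong (Maybe.map _) (splitU-plug η j ξ)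

plug-U-unique : ∀ {n} {η η′ : Adm n} {j j′ ξ ξ′} → plug η (U j ξ) ≡ plug η′ (U j′ ξ′) →
                (η , j , ξ) ≡ (η′ , j′ , ξ′)
plug-U-unique {η = η} {η′} {j} {j′} {ξ} {ξ′} eq =
  just-injective (trans (sym (splitU-plug η j ξ)) (trans (cong splitU eq) (splitU-plug η′ j′ ξ′)))

module Lindenbaum (em : ExcludedMiddle (lsuc 0ℓ)) {n : ℕ} (s : Sᶜ n) (i : Fin n) (φ : Form n)
                 (Kφ∉ : ¬ proj₁ s (K i φ)) where
  open MaximalConsistent s

  decide : (P : Set) → Dec P
  decide P = map′ lower lift (em {Lift (lsuc 0ℓ) P})

  -- L together with {χ | K i χ ∈ s} proves χ.
  Derives : List (Form n) → Form n → Set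
  Derives L χ = Γ (K i (⋀ L ⇒ χ))

  Consistent : List (Form n) → Set
  Consistent L = ¬ Derives L φ

  derives-⊢ : ∀ {L χ} → ⊢ χ → Derives L χ
  derives-⊢ = theorem∈ ∘ NecK ∘ MP ⇒-weaken

  derives-K : ∀ {L χ} → Γ (K i χ) → Derives L χ
  derives-K = K-⊢⇒∈ ⇒-weaken

  derives-∈ : ∀ {L χ} → χ ∈ L → Derives L χ
  derives-∈ = theorem∈ ∘ NecK ∘ ⋀-∈

  derives-⊆ : ∀ {L L′ χ} → L ⊆ L′ → Derives L χ → Derives L′ χ
  derives-⊆ L⊆L′ = K-⊢⇒∈₂ ⇒-trans (theorem∈ (NecK (⋀-⊆ L⊆L′)))

  derives-mp : ∀ {L χ ξ} → Derives L (χ ⇒ ξ) → Derives L χ → Derives L ξ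
  derives-mp = K-⊢⇒∈₂ ⇒-mp

  derives-clash : ∀ {L χ} → Derives L χ → Derives L (~ χ) → ¬ Consistent L
  derives-clash χ ~χ c = c (K-⊢⇒∈₂ ⇒-clash χ ~χ)

  consistent-[] : Consistent []
  consistent-[] = Kφ∉ ∘ K-⊢⇒∈ ⊤-⇒-elim

  consistent-~ : ∀ {L χ} → Consistent L → ¬ Consistent (χ ∷ L) → Consistent (~ χ ∷ L)
  consistent-~ c χ-inconsistent = c ∘ K-⊢⇒∈₂ &-⇒-cases (∈-stable χ-inconsistent)

  RUinstance : Adm n → Fin n → Form n → EL n → Form n
  RUinstance η j ξ ψ = plug η (RUprem j ξ ψ)

  -- If every instance of the premise were derivable from ¬χ ∷ L, then by RU inside s so
  -- would be χ = η(U_j ξ) itself, and ¬χ ∷ L would be inconsistent.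
  ru-witness : ∀ {L η j ξ} → Consistent L → ¬ Consistent (plug η (U j ξ) ∷ L) →
               Σ (EL n) λ ψ → Consistent (~ RUinstance η j ξ ψ ∷ ~ plug η (U j ξ) ∷ L)
  ru-witness {L} {η} {j} {ξ} c χ-inconsistent =
    decidable-stable (decide _) λ no-witness →
      consistent-~ c χ-inconsistent (K-⊢⇒∈ &-⇒-reductio
        (ru∈ (Kη i (((~ plug η (U j ξ) & ⋀ L) & ~ φ) ⇒η η)) j ξ λ ψ →
          K-⊢⇒∈ &-⇒-contrapose (∈-stable λ ψ-consistent → no-witness (ψ , ψ-consistent))))

  WitnessedIn : List (Form n) → Adm n → Fin n → Form n → Set
  WitnessedIn L η j ξ = Σ (EL n) λ ψ → ~ RUinstance η j ξ ψ ∈ L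

  record Settled (L : List (Form n)) (χ : Form n) : Set where
    field
      decided   : χ ∈ L ⊎ ~ χ ∈ L
      -- the invariant that makes the limit closed under RU
      witnessed : ∀ {η j ξ} → χ ≡ plug η (U j ξ) → χ ∈ L ⊎ WitnessedIn L η j ξ

  settled-⊆ : ∀ {L L′ χ} → L ⊆ L′ → Settled L χ → Settled L′ χ
  settled-⊆ L⊆L′ st = record
    { decided   = Sum.map L⊆L′ L⊆L′ decided
    ; witnessed = Sum.map L⊆L′ (Product.map₂ L⊆L′) ∘ witnessed
    }
    where open Settled st

  record Extension (L χs : List (Form n)) : Set where
    field
      list       : List (Form n)
      ⊇          : L ⊆ list
      consistent : Consistent list
      settles    : ∀ {χ} → χ ∈ χs → Settled list χ

  extension-by : ∀ {L χ} L′ → L ⊆ L′ → Consistent L′ → Settled L′ χ → Extension L (χ ∷ [])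
  extension-by L′ L⊆L′ c st = record
    { list = L′ ; ⊇ = L⊆L′ ; consistent = c ; settles = λ { (here refl) → st } }

  extend₁ : ∀ χ L → Consistent L → Extension L (χ ∷ [])
  extend₁ χ L c with decide (Consistent (χ ∷ L))
  ... | yes χ-consistent = extension-by (χ ∷ L) there χ-consistent record
    { decided = inj₁ (here refl) ; witnessed = λ _ → inj₁ (here refl) }
  ... | no χ-inconsistent
    with decide (Σ (Adm n × Fin n × Form n) λ (η , j , ξ) → χ ≡ plug η (U j ξ))
  ...   | no not-U = extension-by (~ χ ∷ L) there (consistent-~ c χ-inconsistent) record
    { decided = inj₂ (here refl) ; witnessed = λ χ≡ → ⊥-elim (not-U (_ , χ≡)) }
  ...   | yes ((η , j , ξ) , refl) with ru-witness c χ-inconsistent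
  ...     | ψ , ψ-consistent =
    extension-by (~ RUinstance η j ξ ψ ∷ ~ χ ∷ L) (there ∘ there) ψ-consistent record
      { decided   = inj₂ (there (here refl))
      ; witnessed = λ χ≡ → inj₂
          (subst (λ (η , j , ξ) → WitnessedIn _ η j ξ) (plug-U-unique χ≡) (ψ , here refl))
      }

  extend : ∀ χs L → Consistent L → Extension L χs
  extend []       L c = record { list = L ; ⊇ = id ; consistent = c ; settles = λ () }
  extend (χ ∷ χs) L c = record
    { list       = E₂.list
    ; ⊇          = E₂.⊇ ∘ E₁.⊇
    ; consistent = E₂.consistent
    ; settles    = λ { (here refl) → settled-⊆ E₂.⊇ (E₁.settles (here refl))
                     ; (there χ∈)  → E₂.settles χ∈ }
    }
    where
      module E₁ = Extension (extend₁ χ L c)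
      module E₂ = Extension (extend χs E₁.list E₁.consistent)

  mutual
    stage : ℕ → List (Form n)
    stage zero    = []
    stage (suc k) = Extension.list (extension k)

    stage-consistent : ∀ k → Consistent (stage k)
    stage-consistent zero    = consistent-[]
    stage-consistent (suc k) = Extension.consistent (extension k)

    extension : ∀ k → Extension (stage k) (enumeration k)
    extension k = extend (enumeration k) (stage k) (stage-consistent k)

  stage-⊆ : ∀ {k k′} → k ≤ k′ → stage k ⊆ stage k′
  stage-⊆ = go ∘ ≤⇒≤′
    where
      go : ∀ {k k′} → k ≤′ k′ → stage k ⊆ stage k′
      go ≤′-refl         = id
      go {k′ = suc k′} (≤′-step k≤′k′) = Extension.⊇ (extension k′) ∘ go k≤′k′

  settled-at-height : ∀ χ → Settled (stage (suc (height χ))) χ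
  settled-at-height χ = Extension.settles (extension (height χ)) (∈-enumeration χ)

  Limit : FSet n
  Limit χ = ∃ λ k → χ ∈ stage k

  limit-join : ∀ {χ ξ} → Limit χ → Limit ξ → ∃ λ k → χ ∈ stage k × ξ ∈ stage k
  limit-join (k , χ∈) (k′ , ξ∈) = k ⊔ⁿ k′ , stage-⊆ (m≤m⊔n k k′) χ∈ , stage-⊆ (m≤n⊔m k k′) ξ∈

  limit-clash : ∀ {χ} → Limit χ → ¬ Limit (~ χ)
  limit-clash χ∈ ~χ∈ with limit-join χ∈ ~χ∈
  ... | k , χ∈ₖ , ~χ∈ₖ = derives-clash (derives-∈ χ∈ₖ) (derives-∈ ~χ∈ₖ) (stage-consistent k)

  limit-decided : ∀ χ → Limit χ ⊎ Limit (~ χ)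
  limit-decided χ = Sum.map (r ,_) (r ,_) (Settled.decided (settled-at-height χ))
    where r = suc (height χ)

  limit-derives : ∀ {k χ} → Derives (stage k) χ → Limit χ
  limit-derives {k} {χ} derives with limit-decided χ
  ... | inj₁ χ∈  = χ∈
  ... | inj₂ (k′ , ~χ∈) = ⊥-elim (derives-clash (derives-⊆ (stage-⊆ (m≤m⊔n k k′)) derives)
                                                 (derives-∈ (stage-⊆ (m≤n⊔m k k′) ~χ∈))
                                                 (stage-consistent (k ⊔ⁿ k′)))

  limit-theorem : ∀ χ → ⊢ χ → Limit χ
  limit-theorem χ = limit-derives {0} ∘ derives-⊢

  limit-mp : ∀ χ ξ → Limit (χ ⇒ ξ) → Limit χ → Limit ξ
  limit-mp χ ξ χ⇒ξ∈ χ∈ with limit-join χ⇒ξ∈ χ∈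
  ... | k , χ⇒ξ∈ₖ , χ∈ₖ = limit-derives {k} (derives-mp (derives-∈ χ⇒ξ∈ₖ) (derives-∈ χ∈ₖ))

  limit-ru : ∀ (η : Adm n) j ξ → ((ψ : EL n) → Limit (RUinstance η j ξ ψ)) → Limit (plug η (U j ξ))
  limit-ru η j ξ premises with Settled.witnessed (settled-at-height (plug η (U j ξ))) refl
  ... | inj₁ χ∈ = suc (height (plug η (U j ξ))) , χ∈
  ... | inj₂ (ψ , ~premise∈) =
    ⊥-elim (limit-clash (premises ψ) (suc (height (plug η (U j ξ))) , ~premise∈))

  limit-⊥f : ¬ Limit ⊥f
  limit-⊥f (k , ⊥f∈) =
    stage-consistent k (derives-mp (derives-⊢ (ex-falso {A = φ})) (derives-∈ ⊥f∈))

  limit-φ : ¬ Limit φ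
  limit-φ (k , φ∈) = stage-consistent k (derives-∈ φ∈)

  limit-K : ∀ χ → Γ (K i χ) → Limit χ
  limit-K χ = limit-derives {0} ∘ derives-K

  limit-mct : IsMCT Limit
  limit-mct = (limit-theorem , limit-mp , limit-ru) , limit-⊥f , limit-decided

existence-lemma : ExcludedMiddle (lsuc 0ℓ) → ∀ {n} (s : Sᶜ n) {i φ} → ¬ proj₁ s (K i φ) →
            Σ (Sᶜ n) λ t → Model.R (Mᶜ n) i s t × ¬ proj₁ t φ
existence-lemma em s Kφ∉ = (Limit , limit-mct) , limit-K , limit-φ
  where open Lindenbaum em s _ _ Kφ∉

Π-⇔ : ∀ {a b c} {X : Set a} {A : X → Set b} {B : X → Set c} →
      (∀ x → A x ⇔ B x) → ((x : X) → A x) ⇔ ((x : X) → B x)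
Π-⇔ A⇔B = mk⇔ (λ f x → to (A⇔B x) (f x)) (λ g x → from (A⇔B x) (g x))

module Validity {n a r v} (M : Model n a r v) where
  open Model M
  open Semantics M

  _∩_ : Dom → (S → Set (a ⊔ r ⊔ v)) → Dom
  (D ∩ P) t = D t × P t

  Same : Dom → Dom → Set (a ⊔ r ⊔ v)
  Same D D′ = ∀ t → D t ⇔ D′ t

  ∩-same : ∀ {D D′ P P′} → Same D D′ → (∀ t → P t ⇔ P′ t) → Same (D ∩ P) (D′ ∩ P′)
  ∩-same D≈D′ P≈P′ t = D≈D′ t ×-⇔ P≈P′ t

  satEL-same : ∀ {D D′} → Same D D′ → ∀ s (ψ : EL n) → satEL D s ψ ⇔ satEL D′ s ψ
  satEL-same D≈D′ s (var p) = ⇔.refl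
  satEL-same D≈D′ s (~ ψ)   = ¬-cong-⇔ (satEL-same D≈D′ s ψ)
  satEL-same D≈D′ s (ψ & χ) = satEL-same D≈D′ s ψ ×-⇔ satEL-same D≈D′ s χ
  satEL-same D≈D′ s (K i ψ) =
    Π-⇔ λ t → →-cong-⇔ (D≈D′ t) (→-cong-⇔ ⇔.refl (satEL-same D≈D′ t ψ))

  sat-same : ∀ {D D′} → Same D D′ → ∀ s φ → sat D s φ ⇔ sat D′ s φ
  sat-same D≈D′ s (var p)   = ⇔.refl
  sat-same D≈D′ s (~ φ)     = ¬-cong-⇔ (sat-same D≈D′ s φ)
  sat-same D≈D′ s (φ & ψ)   = sat-same D≈D′ s φ ×-⇔ sat-same D≈D′ s ψ
  sat-same D≈D′ s (K i φ)   =
    Π-⇔ λ t → →-cong-⇔ (D≈D′ t) (→-cong-⇔ ⇔.refl (sat-same D≈D′ t φ))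
  sat-same D≈D′ s ([ ψ ] φ) =
    →-cong-⇔ (sat-same D≈D′ s ψ) (sat-same (∩-same D≈D′ λ t → sat-same D≈D′ t ψ) s φ)
  sat-same D≈D′ s (U i φ)   = sat-same D≈D′ s φ ×-⇔ Π-⇔ λ ψ →
    →-cong-⇔ (satEL-same D≈D′ s ψ) (¬-cong-⇔ (Π-⇔ λ t →
      →-cong-⇔ (∩-same D≈D′ (λ u → satEL-same D≈D′ u ψ) t)
        (→-cong-⇔ ⇔.refl (sat-same (∩-same D≈D′ λ u → satEL-same D≈D′ u ψ) t φ))))

  satEL⇔sat : ∀ D s (ψ : EL n) → satEL D s ψ ⇔ sat D s ⌜ ψ ⌝
  satEL⇔sat D s (var p) = ⇔.refl
  satEL⇔sat D s (~ ψ)   = ¬-cong-⇔ (satEL⇔sat D s ψ)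
  satEL⇔sat D s (ψ & χ) = satEL⇔sat D s ψ ×-⇔ satEL⇔sat D s χ
  satEL⇔sat D s (K i ψ) = Π-⇔ λ t → →-cong-⇔ ⇔.refl (→-cong-⇔ ⇔.refl (satEL⇔sat D t ψ))

  sat-[]& : ∀ D s Ψ φ χ → sat D s ([ Ψ ] (φ & χ)) ⇔ sat D s ([ Ψ ] φ & [ Ψ ] χ)
  sat-[]& D s Ψ φ χ = mk⇔ (λ h → proj₁ ∘ h , proj₂ ∘ h) (λ (f , g) Ψ⊨ → f Ψ⊨ , g Ψ⊨)

  sat-[][] : ∀ D s Ψ χ φ → sat D s ([ Ψ ] [ χ ] φ) ⇔ sat D s ([ Ψ & [ Ψ ] χ ] φ)
  sat-[][] D s Ψ χ φ =
    mk⇔ (λ h (Ψ⊨ , χ⊨) → to (sat-same restrictions s φ) (h Ψ⊨ (χ⊨ Ψ⊨)))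
        (λ h Ψ⊨ χ⊨ → from (sat-same restrictions s φ) (h (Ψ⊨ , λ _ → χ⊨)))
    where
      restrictions : Same ((D ∩ λ t → sat D t Ψ) ∩ λ t → sat (D ∩ λ u → sat D u Ψ) t χ)
                          (D ∩ λ t → sat D t (Ψ & [ Ψ ] χ))
      restrictions t = mk⇔ (λ ((d , Ψ⊨) , χ⊨) → d , Ψ⊨ , λ _ → χ⊨)
                           (λ (d , Ψ⊨ , χ⊨) → (d , Ψ⊨) , χ⊨ Ψ⊨)

  sat-U : ∀ D s j φ → sat D s (U j φ) ⇔ (sat D s φ × ((ψ : EL n) → sat D s ([ ⌜ ψ ⌝ ] ~ K j φ)))
  sat-U D s j φ = ⇔.refl ×-⇔ Π-⇔ λ ψ →
    →-cong-⇔ (satEL⇔sat D s ψ)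
             (sat-same (∩-same (λ _ → ⇔.refl) (λ t → satEL⇔sat D t ψ)) s (~ K j φ))

  sat-[]U : ∀ D s Ψ j φ → sat D s ([ Ψ ] U j φ) ⇔
            (sat D s ([ Ψ ] φ) × ((ψ : EL n) → sat D s ([ Ψ ] [ ⌜ ψ ⌝ ] ~ K j φ)))
  sat-[]U D s Ψ j φ = ⇔.trans (→-cong-⇔ ⇔.refl (sat-U (D ∩ λ t → sat D t Ψ) s j φ))
    (mk⇔ (λ h → proj₁ ∘ h , λ ψ Ψ⊨ → proj₂ (h Ψ⊨) ψ) (λ (f , g) Ψ⊨ → f Ψ⊨ , λ ψ → g ψ Ψ⊨))

  module _ (em : ExcludedMiddle (a ⊔ r ⊔ v)) where

    sat-⇒ : ∀ D s φ ψ → sat D s (φ ⇒ ψ) ⇔ (sat D s φ → sat D s ψ)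
    sat-⇒ D s φ ψ = mk⇔ (λ h φ⊨ → decidable-stable em λ ψ⊭ → h (φ⊨ , ψ⊭))
                        (λ f (φ⊨ , ψ⊭) → ψ⊭ (f φ⊨))

    sat-[]var : ∀ D s Ψ p → sat D s ([ Ψ ] var p) ⇔ sat D s (Ψ ⇒ var p)
    sat-[]var D s Ψ p = ⇔.sym (sat-⇒ D s Ψ (var p))

    sat-[]~ : ∀ D s Ψ φ → sat D s ([ Ψ ] ~ φ) ⇔ sat D s (Ψ ⇒ ~ ([ Ψ ] φ))
    sat-[]~ D s Ψ φ = ⇔.trans (mk⇔ (λ h Ψ⊨ φ⊨ → h Ψ⊨ (φ⊨ Ψ⊨)) (λ h Ψ⊨ φ⊨ → h Ψ⊨ λ _ → φ⊨))
                              (⇔.sym (sat-⇒ D s Ψ (~ ([ Ψ ] φ))))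

    sat-[]K : ∀ D s Ψ j φ → sat D s ([ Ψ ] K j φ) ⇔ sat D s (Ψ ⇒ K j ([ Ψ ] φ))
    sat-[]K D s Ψ j φ =
      ⇔.trans (mk⇔ (λ h Ψ⊨ t d sRt Ψ⊨t → h Ψ⊨ t (d , Ψ⊨t) sRt)
                   (λ h Ψ⊨ t (d , Ψ⊨t) sRt → h Ψ⊨ t d sRt Ψ⊨t))
              (⇔.sym (sat-⇒ D s Ψ (K j ([ Ψ ] φ))))

U-rank : ∀ {n} → Form n → ℕ
U-rank (var p)   = 0
U-rank (~ φ)     = U-rank φ
U-rank (φ & ψ)   = U-rank φ ⊔ⁿ U-rank ψ
U-rank (K i φ)   = U-rank φ
U-rank ([ φ ] ψ) = U-rank φ + U-rank ψ
U-rank (U i φ)   = suc (U-rank φ)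

-- The weight 5 + complexity φ is what makes each reduction axiom decrease complexity.
complexity : ∀ {n} → Form n → ℕ
complexity (var p)   = 1
complexity (~ φ)     = suc (complexity φ)
complexity (φ & ψ)   = suc (complexity φ + complexity ψ)
complexity (K i φ)   = suc (complexity φ)
complexity ([ φ ] ψ) = (5 + complexity φ) * complexity ψ
complexity (U i φ)   = suc (complexity φ)

complexity-pos : ∀ {n} (φ : Form n) → 0 < complexity φ
complexity-pos (var p)   = s≤s z≤n
complexity-pos (~ φ)     = s≤s z≤n
complexity-pos (φ & ψ)   = s≤s z≤n
complexity-pos (K i φ)   = s≤s z≤n
complexity-pos ([ φ ] ψ) = *-mono-< {0} {5 + complexity φ} (s≤s z≤n) (complexity-pos ψ)
complexity-pos (U i φ)   = s≤s z≤n

U-rank-EL : ∀ {n} (ψ : EL n) → U-rank ⌜ ψ ⌝ ≡ 0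
U-rank-EL (var p) = refl
U-rank-EL (~ ψ)   = U-rank-EL ψ
U-rank-EL (ψ & χ) = cong₂ _⊔ⁿ_ (U-rank-EL ψ) (U-rank-EL χ)
U-rank-EL (K i ψ) = U-rank-EL ψ

U-rank-<-U : ∀ {n} (ψ : EL n) j φ → U-rank ([ ⌜ ψ ⌝ ] ~ K j φ) < U-rank (U j φ)
U-rank-<-U ψ j φ = s≤s (≤-reflexive (cong (_+ U-rank φ) (U-rank-EL ψ)))

n≡m+1+d⇒m<n : ∀ m n d → n ≡ m + suc d → m < n
n≡m+1+d⇒m<n m n d eq = subst (m <_) (sym eq) (m<m+n m (s≤s z≤n))

infix 4 _≺_

_≺_ : ∀ {n} → Form n → Form n → Set
Y ≺ X = U-rank Y ≤ U-rank X × complexity Y < complexity X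

module _ {n : ℕ} (Ψ : Form n) where

  ≺-[]var : ∀ p → (Ψ ⇒ var p) ≺ [ Ψ ] var p
  ≺-[]var p = ⊔-lub (m≤m+n (U-rank Ψ) 0) z≤n , n≡m+1+d⇒m<n _ _ 0 (arith (complexity Ψ))
    where
      arith : ∀ x → (5 + x) * 1 ≡ suc (suc (x + 2)) + 1
      arith = solve-∀

  ≺-[]~ : ∀ φ → (Ψ ⇒ ~ ([ Ψ ] φ)) ≺ [ Ψ ] ~ φ
  ≺-[]~ φ = ⊔-lub (m≤m+n (U-rank Ψ) (U-rank φ)) ≤-refl ,
            n≡m+1+d⇒m<n _ _ 0 (arith (complexity Ψ) (complexity φ))
    where
      arith : ∀ x y → (5 + x) * suc y ≡ suc (suc (x + suc (suc ((5 + x) * y)))) + 1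
      arith = solve-∀

  ≺-[]& : ∀ φ χ → [ Ψ ] φ & [ Ψ ] χ ≺ [ Ψ ] (φ & χ)
  ≺-[]& φ χ = ≤-reflexive (sym (+-distribˡ-⊔ (U-rank Ψ) (U-rank φ) (U-rank χ))) ,
              n≡m+1+d⇒m<n _ _ (3 + complexity Ψ)
                (arith (complexity Ψ) (complexity φ) (complexity χ))
    where
      arith : ∀ x y z → (5 + x) * suc (y + z) ≡ suc ((5 + x) * y + (5 + x) * z) + suc (3 + x)
      arith = solve-∀

  ≺-[]K : ∀ j φ → (Ψ ⇒ K j ([ Ψ ] φ)) ≺ [ Ψ ] K j φ
  ≺-[]K j φ = ≺-[]~ φ

  ≺-[][] : ∀ χ φ → [ Ψ & [ Ψ ] χ ] φ ≺ [ Ψ ] [ χ ] φ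
  ≺-[][] χ φ =
    ≤-trans (+-monoˡ-≤ (U-rank φ) (⊔-lub (m≤m+n (U-rank Ψ) (U-rank χ)) ≤-refl))
            (≤-reflexive (+-assoc (U-rank Ψ) (U-rank χ) (U-rank φ))) ,
    arith (complexity Ψ) (complexity φ) (complexity χ) (complexity-pos φ)
    where
      arith : ∀ x y z → 0 < y → (5 + suc (x + (5 + x) * z)) * y < (5 + x) * ((5 + z) * y)
      arith x (suc y) z _ = n≡m+1+d⇒m<n _ _ (18 + 4 * x + (19 + 4 * x) * y) (eq x y z)
        where
          eq : ∀ x y z → (5 + x) * ((5 + z) * suc y) ≡
                         (5 + suc (x + (5 + x) * z)) * suc y + suc (18 + 4 * x + (19 + 4 * x) * y)
          eq = solve-∀

module TruthLemma (em : ExcludedMiddle (lsuc 0ℓ)) {n : ℕ} where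
  open Semantics (Mᶜ n)
  open Validity (Mᶜ n)

  Full : Dom
  Full _ = Lift (lsuc 0ℓ) ⊤

  Truth : Form n → Set₁
  Truth X = ∀ (s : Sᶜ n) → s ⊨ X ⇔ proj₁ s X

  truth-by-reduction : ∀ {X Y} → ⊢ (X ⇔f Y) → (∀ s → s ⊨ X ⇔ s ⊨ Y) → Truth Y → Truth X
  truth-by-reduction X⇔Y ⊨X⇔⊨Y truth-Y s =
    ⇔.trans (⊨X⇔⊨Y s) (⇔.trans (truth-Y s) (⇔.sym (MaximalConsistent.⇔f∈ s X⇔Y)))

  truth-K : ∀ j φ → Truth φ → Truth (K j φ)
  truth-K j φ truth-φ s = mk⇔
    (λ ⊨Kφ → ∈-stable λ Kφ∉ →
      let (t , sRt , φ∉t) = existence-lemma em s Kφ∉ in φ∉t (to (truth-φ t) (⊨Kφ t _ sRt)))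
    (λ Kφ∈ t _ sRt → from (truth-φ t) (sRt φ Kφ∈))
    where open MaximalConsistent s

  truth-step : ∀ X → (∀ Y → Y ≺ X → Truth Y) → (∀ Y → U-rank Y < U-rank X → Truth Y) → Truth X
  truth-step (var p) _ _ s = mk⇔ lower lift
  truth-step (~ φ) IH _ s = ⇔.trans (¬-cong-⇔ (IH φ (≤-refl , ≤-refl) s)) (mk⇔ ∉⇒~∈ ~∈⇒∉)
    where open MaximalConsistent s
  truth-step (φ & ψ) IH _ s = ⇔.trans (IH φ ≺ˡ s ×-⇔ IH ψ ≺ʳ s) (⇔.sym &∈⇔)
    where
      open MaximalConsistent s
      ≺ˡ : φ ≺ φ & ψ
      ≺ˡ = m≤m⊔n (U-rank φ) (U-rank ψ) , s≤s (m≤m+n (complexity φ) (complexity ψ))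
      ≺ʳ : ψ ≺ φ & ψ
      ≺ʳ = m≤n⊔m (U-rank φ) (U-rank ψ) , s≤s (m≤n+m (complexity ψ) (complexity φ))
  truth-step (K j φ) IH _ = truth-K j φ (IH φ (≤-refl , ≤-refl))
  truth-step (U j φ) _ IH s =
    ⇔.trans (sat-U Full s j φ)
      (⇔.trans (IH φ ≤-refl s ×-⇔ Π-⇔ λ ψ → IH _ (U-rank-<-U ψ j φ) s) (⇔.sym U∈⇔))
    where open MaximalConsistent s
  truth-step ([ Ψ ] var p) IH _ =
    truth-by-reduction A-atom (λ s → sat-[]var em Full s Ψ p) (IH _ (≺-[]var Ψ p))
  truth-step ([ Ψ ] ~ φ) IH _ =
    truth-by-reduction A-neg (λ s → sat-[]~ em Full s Ψ φ) (IH _ (≺-[]~ Ψ φ))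
  truth-step ([ Ψ ] (φ & χ)) IH _ =
    truth-by-reduction A-conj (λ s → sat-[]& Full s Ψ φ χ) (IH _ (≺-[]& Ψ φ χ))
  truth-step ([ Ψ ] K j φ) IH _ =
    truth-by-reduction A-K (λ s → sat-[]K em Full s Ψ j φ) (IH _ (≺-[]K Ψ j φ))
  truth-step ([ Ψ ] [ χ ] φ) IH _ =
    truth-by-reduction A-comp (λ s → sat-[][] Full s Ψ χ φ) (IH _ (≺-[][] Ψ χ φ))
  truth-step ([ Ψ ] U j φ) _ IH s =
    ⇔.trans (sat-[]U Full s Ψ j φ)
      (⇔.trans (IH _ (+-monoʳ-< (U-rank Ψ) ≤-refl) s ×-⇔
                Π-⇔ λ ψ → IH _ (+-monoʳ-< (U-rank Ψ) (U-rank-<-U ψ j φ)) s)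
               (⇔.sym []U∈⇔))
    where open MaximalConsistent s

  truth-bounded : ∀ m k X → U-rank X < m → complexity X < k → Truth X
  truth-bounded (suc m) (suc k) X u<m c<k = truth-step X
    (λ Y (uY≤uX , cY<cX) →
      truth-bounded (suc m) k Y (≤-<-trans uY≤uX u<m) (≤-trans cY<cX (≤-pred c<k)))
    (λ Y uY<uX → truth-bounded m (suc (complexity Y)) Y (≤-trans uY<uX (≤-pred u<m)) ≤-refl)

  truth : ∀ X → Truth X
  truth X = truth-bounded (suc (U-rank X)) (suc (complexity X)) X ≤-refl ≤-refl

mainTheorem20 : ExcludedMiddle (lsuc 0ℓ) →
    ∀ {n : ℕ} (s : Sᶜ n) (φ : Form n) →
    (Semantics._⊨_ (Mᶜ n) s φ) ⇔ proj₁ s φ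
mainTheorem20 em s φ = TruthLemma.truth em φ s
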